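{- Let $K$ be a finite set, $\phi\in L[K]$, $J\subseteq K$, $\lambda\in\mathcal S^\phi$, and $\mu\in\mathcal S^{\phi|_J}$ with $\mu\supseteq\lambda_J$. Then $$\sum_{\substack{\nu\in\mathcal S^{\phi|_J}\\ \mu\supseteq\nu\supseteq\lambda_J}}\frac{(-1)^{|\mu\setminus\nu|}}{q^{\mathrm{nst}^\mu_{\mu\setminus\nu}+\mathrm{nst}^\lambda_{\nu\setminus\lambda_J}}}=\prod_{i\frown j\in\mu\setminus\lambda_J}\Big(\frac{1}{q^{\mathrm{nst}^\lambda_{i\frown j}}}-\frac{1}{q^{\mathrm{nst}^\mu_{i\frown j}}}\Big).$$
   Context: $q$ is a fixed prime power (any nonzero number works for the identity). For a finite set $K$, $L[K]$ is the set of linear orders on $K$ ($i\prec_\phi j$: $i$ before $j$ in $\phi$); $\phi|_J$ is the restriction to $J\subseteq K$. For $\phi\in L[K]$, a set partition w.r.t. $\phi$ is a set $\lambda$ of arcs $i\frown j$ with $i\frown j\in\lambda\Rightarrow i\prec_\phi j$ and, for $i\frown l,j\frown k\in\lambda$, $i=j$ iff $k=l$; $\mathcal S^\phi$ is the set of these; $|\lambda|$ is the number of arcs; $\lambda_J=\{i\frown j\in\lambda:i,j\in J\}$. For sets of arcs $\alpha,\beta$ on $K$, $\mathrm{nst}^\alpha_\beta=\#\{(i\frown l,j\frown k)\in\alpha\times\beta:i\prec_\phi j\prec_\phi k\prec_\phi l\}$ (computed in the order $\phi$), and $\mathrm{nst}^\alpha_{i\frown j}=\mathrm{nst}^\alpha_{\{i\frown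 j\}}$. -}

module Defs where

open import Data.Nat as ℕ using (ℕ; zero; suc; _<ᵇ_; _≥_)
open import Data.Nat.Properties using (m^n≢0)
open import Data.Nat.Primality using (Prime; prime⇒nonZero)
open import Data.Fin as Fin using (Fin; toℕ)
open import Data.Fin.Permutation using (Permutation′; _⟨$⟩ʳ_)
open import Data.Bool using (Bool; true; false; _∧_; _∨_; not; if_then_else_)
open import Data.List using (List; []; _∷_; map; concatMap; allFin; filterᵇ; foldr)
open import Data.Nat.ListAction using (sum)
open import Data.Bool.ListAction using (all)
open import Data.Product using (Σ; _×_; ∃; _,_)
open import Data.Integer using (+_)
open import Data.Rational as ℚ using (ℚ; 0ℚ; 1ℚ; _+_; _*_; _-_)
open import Relation.Nullary using (does)
open import Relation.Binary.PropositionalEquality using (_≡_; refl)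

IsPrimePower : ℕ → Set
IsPrimePower q = Σ ℕ λ p → Σ ℕ λ k → Prime p × k ≥ 1 × q ≡ p ℕ.^ k

primePower-nonZero : ∀ {q} → IsPrimePower q → ℕ.NonZero q
primePower-nonZero (p , k , pr , _ , refl) = m^n≢0 p k {{prime⇒nonZero pr}}

invPow : (q : ℕ) → IsPrimePower q → ℕ → ℚ
invPow q pp m = (+ 1) ℚ./ (q ℕ.^ m)
  where instance
    _ = primePower-nonZero pp
    _ = m^n≢0 q m

_^ℚ_ : ℚ → ℕ → ℚ
x ^ℚ zero  = 1ℚ
x ^ℚ suc k = x * (x ^ℚ k)

-- The finite set K is Fin n; a linear order φ ∈ L[K] is given by a
-- permutation (φ ⟨$⟩ʳ i = position of i in φ).

LinOrd : ℕ → Set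
LinOrd n = Permutation′ n

_≺[_]_ : ∀ {n} → Fin n → LinOrd n → Fin n → Bool
i ≺[ φ ] j = toℕ (φ ⟨$⟩ʳ i) <ᵇ toℕ (φ ⟨$⟩ʳ j)

_==_ : ∀ {n} → Fin n → Fin n → Bool
i == j = does (i Fin.≟ j)

-- subsets J ⊆ K, and sets of arcs (α i j = true  iff  i⌢j ∈ α)
Sub : ℕ → Set
Sub n = Fin n → Bool

full : ∀ {n} → Sub n
full _ = true

Arcs : ℕ → Set
Arcs n = Fin n → Fin n → Bool

∀ᵇ : ∀ {n} → (Fin n → Bool) → Bool
∀ᵇ {n} f = all f (allFin n)

count : ∀ {n} → (Fin n → ℕ) → ℕ
count {n} f = sum (map f (allFin n))

ind : Bool → ℕ
ind true = 1
ind false = 0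

_⇒ᵇ_ : Bool → Bool → Bool
a ⇒ᵇ b = not a ∨ b

_⇔ᵇ_ : Bool → Bool → Bool
true  ⇔ᵇ b = b
false ⇔ᵇ b = not b

-- λ ∈ S^{φ|_J}: a set partition w.r.t. the restriction φ|_J
-- (arcs live on J, i⌢j ∈ λ ⇒ i ≺ j, and for i⌢l, j⌢k ∈ λ: i = j ⇔ k = l)
isSetPartition : ∀ {n} → LinOrd n → Sub n → Arcs n → Bool
isSetPartition φ J lam =
  ∀ᵇ (λ i → ∀ᵇ (λ j → lam i j ⇒ᵇ (J i ∧ J j ∧ (i ≺[ φ ] j))))
  ∧ ∀ᵇ (λ i → ∀ᵇ (λ l → ∀ᵇ (λ j → ∀ᵇ (λ k →
      (lam i l ∧ lam j k) ⇒ᵇ ((i == j) ⇔ᵇ (k == l))))))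

restrict : ∀ {n} → Sub n → Arcs n → Arcs n
restrict J lam i j = lam i j ∧ J i ∧ J j

_⊆ᵇ_ : ∀ {n} → Arcs n → Arcs n → Bool
α ⊆ᵇ β = ∀ᵇ (λ i → ∀ᵇ (λ j → α i j ⇒ᵇ β i j))

_∖_ : ∀ {n} → Arcs n → Arcs n → Arcs n
(α ∖ β) i j = α i j ∧ not (β i j)

size : ∀ {n} → Arcs n → ℕ
size α = count (λ i → count (λ j → ind (α i j)))

arc : ∀ {n} → Fin n → Fin n → Arcs n
arc i j a b = (a == i) ∧ (b == j)

nst : ∀ {n} → LinOrd n → Arcs n → Arcs n → ℕ
nst φ α β =
  count (λ i → count (λ l → count (λ j → count (λ k →
    ind (α i l ∧ β j k ∧ (i ≺[ φ ] j) ∧ (j ≺[ φ ] k) ∧ (k ≺[ φ ] l))))))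

funs : ∀ {B : Set} (m : ℕ) → List B → List (Fin m → B)
funs zero    bs = (λ ()) ∷ []
funs (suc m) bs =
  concatMap (λ b → map (λ f → λ { Fin.zero → b ; (Fin.suc i) → f i }) (funs m bs)) bs

allArcs : (n : ℕ) → List (Arcs n)
allArcs n = funs n (funs n (true ∷ false ∷ []))

Σℚ : ∀ {A : Set} → List A → (A → ℚ) → ℚ
Σℚ xs f = foldr (λ x acc → f x + acc) 0ℚ xs

Πarcs : ∀ {n} → Arcs n → (Fin n → Fin n → ℚ) → ℚ
Πarcs {n} α f =
  foldr _*_ 1ℚ (concatMap (λ i → map (λ j → if α i j then f i j else 1ℚ) (allFin n)) (allFin n))

LHS : (q : ℕ) → IsPrimePower q → ∀ {n} → LinOrd n → Sub n → Arcs n → Arcs n → ℚ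
LHS q pp {n} φ J lam μ =
  Σℚ (filterᵇ (λ ν → isSetPartition φ J ν ∧ (ν ⊆ᵇ μ) ∧ (restrict J lam ⊆ᵇ ν)) (allArcs n))
     (λ ν → ((ℚ.- 1ℚ) ^ℚ size (μ ∖ ν))
            * invPow q pp (nst φ μ (μ ∖ ν) ℕ.+ nst φ lam (ν ∖ restrict J lam)))

RHS : (q : ℕ) → IsPrimePower q → ∀ {n} → LinOrd n → Sub n → Arcs n → Arcs n → ℚ
RHS q pp φ J lam μ =
  Πarcs (μ ∖ restrict J lam)
        (λ i j → invPow q pp (nst φ lam (arc i j)) - invPow q pp (nst φ μ (arc i j)))

-- Since μ is a set partition, so is every ν ⊆ μ; the sum therefore runs over all ν with
-- λ_J ⊆ ν ⊆ μ, i.e. over an independent choice, for each arc, of whether it lies in ν.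
-- The sign (-1)^|μ∖ν| and the weight q^-(nst^μ_{μ∖ν} + nst^λ_{ν∖λ_J}) are both
-- multiplicative over arcs, because nst^α_β is additive in β.  So the summand factors
-- arc by arc, the sum of products is the product of the one-arc sums, and the one-arc sum
-- is q^-nst^λ_{i⌢j} - q^-nst^μ_{i⌢j} for an arc of μ ∖ λ_J and 1 for every other arc.
module Submission where

open import Defs
open import Data.Bool using (Bool; true; false; _∧_; not; if_then_else_; T)
open import Data.Bool.ListAction using (all)
open import Data.Bool.Properties using (T-∧; ∧-zeroʳ)
open import Data.Fin using (Fin; zero; suc)
open import Data.Integer using (1ℤ)
open import Data.List using (List; []; _∷_; map; concatMap; filterᵇ; foldr; tabulate; _++_; allFin)
import Data.List.Relation.Unary.All as All
open import Data.List.Relation.Unary.All.Properties using (all⁺; all⁻; tabulate⁺)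
open import Data.List.Membership.Propositional.Properties using (∈-allFin)
open import Data.Nat as ℕ using (ℕ; zero; suc)
import Data.Nat.Properties as ℕ
import Data.Nat.ListAction as List
open import Data.Product using (_,_; proj₁; proj₂)
open import Data.Empty using (⊥-elim)
open import Data.Rational as ℚ using (ℚ; 0ℚ; 1ℚ; _+_; _*_; _-_; -_; _/_)
import Data.Rational.Properties as ℚ
open import Data.Rational.Solver using (module +-*-Solver)
import Data.Rational.Unnormalised as ℚᵘ
import Data.Rational.Unnormalised.Properties as ℚᵘ
open import Function using (_∘_; id; Equivalence)
open import Relation.Binary.PropositionalEquality

open import Algebra.Properties.Semiring.Sum ℕ.+-*-semiring
  using (sum; ∑-comm; *-distribˡ-sum; sum-cong-≗; sum-replicate-zero)
open import Algebra.Properties.CommutativeMonoid.Sum ℚ.*-1-commutativeMonoid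
  using () renaming (sum to ∏; ∑-distrib-+ to ∏-distrib-*; sum-cong-≗ to ∏-cong)

infix 5 ∑-syntax ∏-syntax

∑-syntax : ∀ n → (Fin n → ℕ) → ℕ
∑-syntax _ = sum

syntax ∑-syntax n (λ i → x) = ∑[ i < n ] x

∏-syntax : ∀ n → (Fin n → ℚ) → ℚ
∏-syntax _ = ∏

syntax ∏-syntax n (λ i → x) = ∏[ i < n ] x

1/m*1/n≡1/[m*n] : ∀ m n .{{_ : ℕ.NonZero m}} .{{_ : ℕ.NonZero n}} →
                  (1ℤ / m) * (1ℤ / n) ≡ (1ℤ / (m ℕ.* n)) {{ℕ.m*n≢0 m n}}
1/m*1/n≡1/[m*n] (suc m) (suc n) = ℚ.toℚᵘ-injective (begin
  ℚ.toℚᵘ ((1ℤ / suc m) * (1ℤ / suc n))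
    ≈⟨ ℚ.toℚᵘ-homo-* (1ℤ / suc m) (1ℤ / suc n) ⟩
  ℚ.toℚᵘ (1ℤ / suc m) ℚᵘ.* ℚ.toℚᵘ (1ℤ / suc n)
    ≈⟨ ℚᵘ.*-cong (ℚ.toℚᵘ-fromℚᵘ (ℚᵘ.mkℚᵘ 1ℤ m)) (ℚ.toℚᵘ-fromℚᵘ (ℚᵘ.mkℚᵘ 1ℤ n)) ⟩
  ℚᵘ.mkℚᵘ 1ℤ m ℚᵘ.* ℚᵘ.mkℚᵘ 1ℤ n
    ≈⟨ ℚᵘ.≃-sym (ℚ.toℚᵘ-fromℚᵘ _) ⟩
  ℚ.toℚᵘ (1ℤ / (suc m ℕ.* suc n))
    ∎)
  where open ℚᵘ.≃-Reasoning

invPow-+ : ∀ q (pp : IsPrimePower q) m k → invPow q pp (m ℕ.+ k) ≡ invPow q pp m * invPow q pp k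
invPow-+ q pp m k =
  trans (ℚ./-cong {1ℤ} {q ℕ.^ (m ℕ.+ k)} {1ℤ} {q ℕ.^ m ℕ.* q ℕ.^ k}
                  {{q^j≢0 (m ℕ.+ k)}} {{ℕ.m*n≢0 (q ℕ.^ m) (q ℕ.^ k) {{q^j≢0 m}} {{q^j≢0 k}}}}
                  refl (ℕ.^-distribˡ-+-* q m k))
        (sym (1/m*1/n≡1/[m*n] (q ℕ.^ m) (q ℕ.^ k) {{q^j≢0 m}} {{q^j≢0 k}}))
  where
  q^j≢0 : ∀ j → ℕ.NonZero (q ℕ.^ j)
  q^j≢0 j = ℕ.m^n≢0 q j {{primePower-nonZero pp}}

^ℚ-+ : ∀ x a b → x ^ℚ (a ℕ.+ b) ≡ x ^ℚ a * x ^ℚ b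
^ℚ-+ x zero    b = sym (ℚ.*-identityˡ _)
^ℚ-+ x (suc a) b = trans (cong (x *_) (^ℚ-+ x a b)) (sym (ℚ.*-assoc x _ _))

homo-∑≡∏ : (h : ℕ → ℚ) → h 0 ≡ 1ℚ → (∀ a b → h (a ℕ.+ b) ≡ h a * h b) →
           ∀ {n} (f : Fin n → ℕ) → h (∑[ i < n ] f i) ≡ ∏[ i < n ] h (f i)
homo-∑≡∏ h h0 h+ {zero}  f = h0
homo-∑≡∏ h h0 h+ {suc n} f = trans (h+ _ _) (cong (h (f zero) *_) (homo-∑≡∏ h h0 h+ (f ∘ suc)))

∑-δ : ∀ {n} (j : Fin n) (f : Fin n → ℕ) → ∑[ i < n ] ind (i == j) ℕ.* f i ≡ f j
∑-δ {suc n} zero    f =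
  trans (cong₂ ℕ._+_ (ℕ.*-identityˡ (f zero)) (sum-replicate-zero n)) (ℕ.+-identityʳ _)
∑-δ {suc n} (suc j) f = ∑-δ j (f ∘ suc)

∑∑-comm : ∀ {a b c d} (f : Fin a → Fin b → Fin c → Fin d → ℕ) →
          ∑[ i < a ] ∑[ l < b ] ∑[ j < c ] ∑[ k < d ] f i l j k ≡
          ∑[ j < c ] ∑[ k < d ] ∑[ i < a ] ∑[ l < b ] f i l j k
∑∑-comm f = begin
  ∑[ i < _ ] ∑[ l < _ ] ∑[ j < _ ] ∑[ k < _ ] f i l j k
    ≡⟨ sum-cong-≗ (λ i → ∑-comm λ l j → ∑[ k < _ ] f i l j k) ⟩
  ∑[ i < _ ] ∑[ j < _ ] ∑[ l < _ ] ∑[ k < _ ] f i l j k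
    ≡⟨ sum-cong-≗ (λ i → sum-cong-≗ λ j → ∑-comm λ l k → f i l j k) ⟩
  ∑[ i < _ ] ∑[ j < _ ] ∑[ k < _ ] ∑[ l < _ ] f i l j k
    ≡⟨ ∑-comm (λ i j → ∑[ k < _ ] ∑[ l < _ ] f i l j k) ⟩
  ∑[ j < _ ] ∑[ i < _ ] ∑[ k < _ ] ∑[ l < _ ] f i l j k
    ≡⟨ sum-cong-≗ (λ j → ∑-comm λ i k → ∑[ l < _ ] f i l j k) ⟩
  ∑[ j < _ ] ∑[ k < _ ] ∑[ i < _ ] ∑[ l < _ ] f i l j k
    ∎
  where open ≡-Reasoning

∑∑-distribˡ : ∀ {n} c (f : Fin n → Fin n → ℕ) →
              c ℕ.* (∑[ i < n ] ∑[ j < n ] f i j) ≡ ∑[ i < n ] ∑[ j < n ] c ℕ.* f i j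
∑∑-distribˡ {n} c f =
  trans (*-distribˡ-sum c λ i → ∑[ j < n ] f i j) (sum-cong-≗ λ i → *-distribˡ-sum c (f i))

homo-∑∑≡∏∏ : (h : ℕ → ℚ) → h 0 ≡ 1ℚ → (∀ a b → h (a ℕ.+ b) ≡ h a * h b) →
             ∀ {n} (f : Fin n → Fin n → ℕ) →
             h (∑[ i < n ] ∑[ j < n ] f i j) ≡ ∏[ i < n ] ∏[ j < n ] h (f i j)
homo-∑∑≡∏∏ h h0 h+ {n} f =
  trans (homo-∑≡∏ h h0 h+ λ i → ∑[ j < n ] f i j) (∏-cong λ i → homo-∑≡∏ h h0 h+ (f i))

∏∏-distrib-* : ∀ {n} (F G : Fin n → Fin n → ℚ) →
               (∏[ i < n ] ∏[ j < n ] F i j) * (∏[ i < n ] ∏[ j < n ] G i j) ≡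
               ∏[ i < n ] ∏[ j < n ] F i j * G i j
∏∏-distrib-* {n} F G =
  sym (trans (∏-cong λ i → ∏-distrib-* (F i) (G i))
             (∏-distrib-* (λ i → ∏[ j < n ] F i j) (λ i → ∏[ j < n ] G i j)))

∏∏-distrib-*³ : ∀ {n} (F G H : Fin n → Fin n → ℚ) →
                (∏[ i < n ] ∏[ j < n ] F i j)
                  * ((∏[ i < n ] ∏[ j < n ] G i j) * (∏[ i < n ] ∏[ j < n ] H i j)) ≡
                ∏[ i < n ] ∏[ j < n ] F i j * (G i j * H i j)
∏∏-distrib-*³ {n} F G H = trans (cong ((∏[ i < n ] ∏[ j < n ] F i j) *_) (∏∏-distrib-* G H))
                                (∏∏-distrib-* F λ i j → G i j * H i j)

sum-map-tabulate : ∀ {A : Set} {n} (f : A → ℕ) (g : Fin n → A) →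
                   List.sum (map f (tabulate g)) ≡ ∑[ i < n ] f (g i)
sum-map-tabulate {n = zero}  f g = refl
sum-map-tabulate {n = suc n} f g = cong (f (g zero) ℕ.+_) (sum-map-tabulate f (g ∘ suc))

count≡∑ : ∀ {n} (f : Fin n → ℕ) → count f ≡ ∑[ i < n ] f i
count≡∑ f = sum-map-tabulate f id

size≡∑∑ : ∀ {n} (α : Arcs n) → size α ≡ ∑[ i < n ] ∑[ j < n ] ind (α i j)
size≡∑∑ α =
  trans (count≡∑ λ i → count λ j → ind (α i j)) (sum-cong-≗ λ i → count≡∑ λ j → ind (α i j))

foldr-*-++ : ∀ xs ys → foldr _*_ 1ℚ (xs ++ ys) ≡ foldr _*_ 1ℚ xs * foldr _*_ 1ℚ ys
foldr-*-++ []       ys = sym (ℚ.*-identityˡ _)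
foldr-*-++ (x ∷ xs) ys = trans (cong (x *_) (foldr-*-++ xs ys)) (sym (ℚ.*-assoc x _ _))

foldr-*-map-tabulate : ∀ {A : Set} {n} (f : A → ℚ) (g : Fin n → A) →
                       foldr _*_ 1ℚ (map f (tabulate g)) ≡ ∏[ i < n ] f (g i)
foldr-*-map-tabulate {n = zero}  f g = refl
foldr-*-map-tabulate {n = suc n} f g = cong (f (g zero) *_) (foldr-*-map-tabulate f (g ∘ suc))

foldr-*-concatMap-tabulate : ∀ {A : Set} {n} (h : A → List ℚ) (g : Fin n → A) →
                             foldr _*_ 1ℚ (concatMap h (tabulate g)) ≡
                             ∏[ i < n ] foldr _*_ 1ℚ (h (g i))
foldr-*-concatMap-tabulate {n = zero}  h g = refl
foldr-*-concatMap-tabulate {n = suc n} h g =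
  trans (foldr-*-++ (h (g zero)) _)
        (cong (foldr _*_ 1ℚ (h (g zero)) *_) (foldr-*-concatMap-tabulate h (g ∘ suc)))

Πarcs≡∏∏ : ∀ {n} (α : Arcs n) (F : Fin n → Fin n → ℚ) →
           Πarcs α F ≡ ∏[ i < n ] ∏[ j < n ] (if α i j then F i j else 1ℚ)
Πarcs≡∏∏ {n} α F = trans (foldr-*-concatMap-tabulate (λ i → map (F′ i) (allFin n)) id)
                          (∏-cong λ i → foldr-*-map-tabulate (F′ i) id)
  where
  F′ : Fin n → Fin n → ℚ
  F′ i j = if α i j then F i j else 1ℚ

ι : Bool → ℚ
ι true  = 1ℚ
ι false = 0ℚ

ι-∧ : ∀ a b → ι (a ∧ b) ≡ ι a * ι b
ι-∧ true  b = sym (ℚ.*-identityˡ _)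
ι-∧ false b = sym (ℚ.*-zeroˡ (ι b))

ι-all-tabulate : ∀ {A : Set} {n} (p : A → Bool) (g : Fin n → A) →
                 ι (all p (tabulate g)) ≡ ∏[ i < n ] ι (p (g i))
ι-all-tabulate {n = zero}  p g = refl
ι-all-tabulate {n = suc n} p g =
  trans (ι-∧ (p (g zero)) _) (cong (ι (p (g zero)) *_) (ι-all-tabulate p (g ∘ suc)))

ι-⊆ᵇ : ∀ {n} (α β : Arcs n) → ι (α ⊆ᵇ β) ≡ ∏[ i < n ] ∏[ j < n ] ι (α i j ⇒ᵇ β i j)
ι-⊆ᵇ α β = trans (ι-all-tabulate (λ i → ∀ᵇ λ j → α i j ⇒ᵇ β i j) id)
                 (∏-cong λ i → ι-all-tabulate (λ j → α i j ⇒ᵇ β i j) id)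

ind-∧ : ∀ a b → ind (a ∧ b) ≡ ind a ℕ.* ind b
ind-∧ true  b = sym (ℕ.+-identityʳ (ind b))
ind-∧ false b = refl

ind-∧-middle : ∀ a b c → ind (a ∧ b ∧ c) ≡ ind b ℕ.* ind (a ∧ c)
ind-∧-middle a true  c = sym (ℕ.+-identityʳ _)
ind-∧-middle a false c = cong ind (∧-zeroʳ a)

-- n is a parameter rather than an implicit argument: T (∀ᵇ f) is stuck on n, so n
-- cannot be inferred from it.
module ∀ᵇ-Reflection (n : ℕ) where

  ∀ᵇ-elim : {f : Fin n → Bool} → T (∀ᵇ f) → ∀ i → T (f i)
  ∀ᵇ-elim {f} t i = All.lookup (all⁺ f (allFin n) t) (∈-allFin i)

  ∀ᵇ-intro : {f : Fin n → Bool} → (∀ i → T (f i)) → T (∀ᵇ f)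
  ∀ᵇ-intro {f} h = all⁻ f (tabulate⁺ h)

⇒ᵇ-elim : ∀ {a b} → T (a ⇒ᵇ b) → T a → T b
⇒ᵇ-elim {true} t _ = t

⇒ᵇ-intro : ∀ {a b} → (T a → T b) → T (a ⇒ᵇ b)
⇒ᵇ-intro {false} _ = _
⇒ᵇ-intro {true}  h = h _

∧-redundantˡ : ∀ {a b} → (T b → T a) → a ∧ b ≡ b
∧-redundantˡ {a}     {false} _ = ∧-zeroʳ a
∧-redundantˡ {true}  {true}  _ = refl
∧-redundantˡ {false} {true}  h = ⊥-elim (h _)

isSetPartition-⊆ : ∀ {n} (φ : LinOrd n) J {ν μ : Arcs n} →
                   T (ν ⊆ᵇ μ) → T (isSetPartition φ J μ) → T (isSetPartition φ J ν)
isSetPartition-⊆ {n} φ J {ν} {μ} ν⊆μ spμ = Equivalence.from T-∧ (ordered-ν , matched-ν)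
  where
  open ∀ᵇ-Reflection n

  Ordered Matched : Arcs n → Bool
  Ordered α = ∀ᵇ λ i → ∀ᵇ λ j → α i j ⇒ᵇ (J i ∧ J j ∧ (i ≺[ φ ] j))
  Matched α = ∀ᵇ λ i → ∀ᵇ λ l → ∀ᵇ λ j → ∀ᵇ λ k → (α i l ∧ α j k) ⇒ᵇ ((i == j) ⇔ᵇ (k == l))

  ordered-μ : T (Ordered μ)
  ordered-μ = proj₁ (Equivalence.to (T-∧ {Ordered μ}) spμ)

  matched-μ : T (Matched μ)
  matched-μ = proj₂ (Equivalence.to (T-∧ {Ordered μ}) spμ)

  ν→μ : ∀ i j → T (ν i j) → T (μ i j)
  ν→μ i j = ⇒ᵇ-elim (∀ᵇ-elim (∀ᵇ-elim ν⊆μ i) j)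

  ordered-ν : T (Ordered ν)
  ordered-ν = ∀ᵇ-intro λ i → ∀ᵇ-intro λ j → ⇒ᵇ-intro λ νij →
    ⇒ᵇ-elim (∀ᵇ-elim (∀ᵇ-elim ordered-μ i) j) (ν→μ i j νij)

  matched-ν : T (Matched ν)
  matched-ν = ∀ᵇ-intro λ i → ∀ᵇ-intro λ l → ∀ᵇ-intro λ j → ∀ᵇ-intro λ k → ⇒ᵇ-intro λ νilνjk →
    let νil , νjk = Equivalence.to (T-∧ {ν i l} {ν j k}) νilνjk in
    ⇒ᵇ-elim (∀ᵇ-elim (∀ᵇ-elim (∀ᵇ-elim (∀ᵇ-elim matched-μ i) l) j) k)
            (Equivalence.from T-∧ (ν→μ i l νil , ν→μ j k νjk))

Σℚ-cong : ∀ {A : Set} xs {f g : A → ℚ} → (∀ x → f x ≡ g x) → Σℚ xs f ≡ Σℚ xs g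
Σℚ-cong []       f≗g = refl
Σℚ-cong (x ∷ xs) f≗g = cong₂ _+_ (f≗g x) (Σℚ-cong xs f≗g)

Σℚ-filterᵇ : ∀ {A : Set} (P : A → Bool) xs f → Σℚ (filterᵇ P xs) f ≡ Σℚ xs (λ x → ι (P x) * f x)
Σℚ-filterᵇ P []       f = refl
Σℚ-filterᵇ P (x ∷ xs) f with P x
... | true  = cong₂ _+_ (sym (ℚ.*-identityˡ (f x))) (Σℚ-filterᵇ P xs f)
... | false = trans (Σℚ-filterᵇ P xs f) (sym (trans (cong (_+ _) (ℚ.*-zeroˡ (f x))) (ℚ.+-identityˡ _)))

Σℚ-++ : ∀ {A : Set} (xs ys : List A) f → Σℚ (xs ++ ys) f ≡ Σℚ xs f + Σℚ ys f
Σℚ-++ []       ys f = sym (ℚ.+-identityˡ _)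
Σℚ-++ (x ∷ xs) ys f = trans (cong (f x +_) (Σℚ-++ xs ys f)) (sym (ℚ.+-assoc (f x) _ _))

Σℚ-map : ∀ {A B : Set} (h : A → B) xs f → Σℚ (map h xs) f ≡ Σℚ xs (f ∘ h)
Σℚ-map h []       f = refl
Σℚ-map h (x ∷ xs) f = cong (f (h x) +_) (Σℚ-map h xs f)

Σℚ-concatMap : ∀ {A B : Set} (g : A → List B) xs f → Σℚ (concatMap g xs) f ≡ Σℚ xs (λ x → Σℚ (g x) f)
Σℚ-concatMap g []       f = refl
Σℚ-concatMap g (x ∷ xs) f = trans (Σℚ-++ (g x) _ f) (cong (Σℚ (g x) f +_) (Σℚ-concatMap g xs f))

Σℚ-*ˡ : ∀ {A : Set} xs c (f : A → ℚ) → Σℚ xs (λ x → c * f x) ≡ c * Σℚ xs f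
Σℚ-*ˡ []       c f = sym (ℚ.*-zeroʳ c)
Σℚ-*ˡ (x ∷ xs) c f = trans (cong (c * f x +_) (Σℚ-*ˡ xs c f)) (sym (ℚ.*-distribˡ-+ c (f x) _))

Σℚ-*ʳ : ∀ {A : Set} xs c (f : A → ℚ) → Σℚ xs (λ x → f x * c) ≡ Σℚ xs f * c
Σℚ-*ʳ []       c f = sym (ℚ.*-zeroˡ c)
Σℚ-*ʳ (x ∷ xs) c f = trans (cong (f x * c +_) (Σℚ-*ʳ xs c f)) (sym (ℚ.*-distribʳ-+ c (f x) _))

Σℚ-funs-∏ : ∀ {B : Set} m (bs : List B) (G : Fin m → B → ℚ) →
            Σℚ (funs m bs) (λ f → ∏[ i < m ] G i (f i)) ≡ ∏[ i < m ] Σℚ bs (G i)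
Σℚ-funs-∏ zero    bs G = ℚ.+-identityʳ 1ℚ
Σℚ-funs-∏ (suc m) bs G = begin
  Σℚ (funs (suc m) bs) (λ f → ∏[ i < suc m ] G i (f i))
    ≡⟨ trans (Σℚ-concatMap _ bs F) (Σℚ-cong bs λ b → Σℚ-map _ (funs m bs) F) ⟩
  Σℚ bs (λ b → Σℚ (funs m bs) (λ f → G zero b * (∏[ i < m ] G (suc i) (f i))))
    ≡⟨ Σℚ-cong bs (λ b → Σℚ-*ˡ (funs m bs) (G zero b) _) ⟩
  Σℚ bs (λ b → G zero b * Σℚ (funs m bs) (λ f → ∏[ i < m ] G (suc i) (f i)))
    ≡⟨ Σℚ-cong bs (λ b → cong (G zero b *_) (Σℚ-funs-∏ m bs (G ∘ suc))) ⟩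
  Σℚ bs (λ b → G zero b * (∏[ i < m ] Σℚ bs (G (suc i))))
    ≡⟨ Σℚ-*ʳ bs _ (G zero) ⟩
  ∏[ i < suc m ] Σℚ bs (G i)
    ∎
  where
  open ≡-Reasoning
  F : (Fin (suc m) → _) → ℚ
  F f = ∏[ i < suc m ] G i (f i)

module _ {n : ℕ} (φ : LinOrd n) where

  nests : Fin n → Fin n → Fin n → Fin n → Bool
  nests i l j k = (i ≺[ φ ] j) ∧ (j ≺[ φ ] k) ∧ (k ≺[ φ ] l)

  nesting : Arcs n → Fin n → Fin n → ℕ
  nesting α j k = ∑[ i < n ] ∑[ l < n ] ind (α i l ∧ nests i l j k)

  nst≡∑ : ∀ α β →
          nst φ α β ≡ ∑[ i < n ] ∑[ l < n ] ∑[ j < n ] ∑[ k < n ] ind (α i l ∧ β j k ∧ nests i l j k)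
  nst≡∑ α β =
    trans (count≡∑ λ i → count λ l → count λ j → count λ k → X i l j k) (sum-cong-≗ λ i →
    trans (count≡∑ λ l → count λ j → count λ k → X i l j k) (sum-cong-≗ λ l →
    trans (count≡∑ λ j → count λ k → X i l j k) (sum-cong-≗ λ j →
    count≡∑ λ k → X i l j k)))
    where
    X : Fin n → Fin n → Fin n → Fin n → ℕ
    X i l j k = ind (α i l ∧ β j k ∧ nests i l j k)

  nst-linearʳ : ∀ α β → nst φ α β ≡ ∑[ j < n ] ∑[ k < n ] ind (β j k) ℕ.* nesting α j k
  nst-linearʳ α β = begin
    nst φ α β
      ≡⟨ nst≡∑ α β ⟩
    ∑[ i < n ] ∑[ l < n ] ∑[ j < n ] ∑[ k < n ] ind (α i l ∧ β j k ∧ nests i l j k)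
      ≡⟨ ∑∑-comm (λ i l j k → ind (α i l ∧ β j k ∧ nests i l j k)) ⟩
    ∑[ j < n ] ∑[ k < n ] ∑[ i < n ] ∑[ l < n ] ind (α i l ∧ β j k ∧ nests i l j k)
      ≡⟨ sum-cong-≗ (λ j → sum-cong-≗ λ k → sym (factor-out j k)) ⟩
    ∑[ j < n ] ∑[ k < n ] ind (β j k) ℕ.* nesting α j k
      ∎
    where
    open ≡-Reasoning
    factor-out : ∀ j k → ind (β j k) ℕ.* nesting α j k ≡
                         ∑[ i < n ] ∑[ l < n ] ind (α i l ∧ β j k ∧ nests i l j k)
    factor-out j k = trans (∑∑-distribˡ (ind (β j k)) λ i l → ind (α i l ∧ nests i l j k))
      (sum-cong-≗ λ i → sum-cong-≗ λ l → sym (ind-∧-middle (α i l) (β j k) (nests i l j k)))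

  nst-arc : ∀ α j k → nst φ α (arc j k) ≡ nesting α j k
  nst-arc α j k = begin
    nst φ α (arc j k)
      ≡⟨ nst-linearʳ α (arc j k) ⟩
    ∑[ j′ < n ] ∑[ k′ < n ] ind ((j′ == j) ∧ (k′ == k)) ℕ.* nesting α j′ k′
      ≡⟨ sum-cong-≗ (λ j′ → trans (sum-cong-≗ (split j′))
           (sym (*-distribˡ-sum (ind (j′ == j)) λ k′ → ind (k′ == k) ℕ.* nesting α j′ k′))) ⟩
    ∑[ j′ < n ] ind (j′ == j) ℕ.* (∑[ k′ < n ] ind (k′ == k) ℕ.* nesting α j′ k′)
      ≡⟨ sum-cong-≗ (λ j′ → cong (ind (j′ == j) ℕ.*_) (∑-δ k (nesting α j′))) ⟩
    ∑[ j′ < n ] ind (j′ == j) ℕ.* nesting α j′ k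
      ≡⟨ ∑-δ j (λ j′ → nesting α j′ k) ⟩
    nesting α j k
      ∎
    where
    open ≡-Reasoning
    split : ∀ j′ k′ → ind ((j′ == j) ∧ (k′ == k)) ℕ.* nesting α j′ k′ ≡
                      ind (j′ == j) ℕ.* (ind (k′ == k) ℕ.* nesting α j′ k′)
    split j′ k′ = trans (cong (ℕ._* nesting α j′ k′) (ind-∧ (j′ == j) (k′ == k)))
                        (ℕ.*-assoc (ind (j′ == j)) (ind (k′ == k)) (nesting α j′ k′))

  nst-linear : ∀ α β → nst φ α β ≡ ∑[ j < n ] ∑[ k < n ] ind (β j k) ℕ.* nst φ α (arc j k)
  nst-linear α β = trans (nst-linearʳ α β)
    (sum-cong-≗ λ j → sum-cong-≗ λ k → cong (ind (β j k) ℕ.*_) (sym (nst-arc α j k)))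

module _ (q : ℕ) (pp : IsPrimePower q) where

  -- The factor of the summand for ν contributed by one arc: m, r, b record whether the
  -- arc lies in μ, λ_J, ν, and D, E are its nesting numbers in μ and in λ.
  arcTerm : (m r b : Bool) (D E : ℕ) → ℚ
  arcTerm m r b D E = (- 1ℚ) ^ℚ ind (m ∧ not b)
                      * (invPow q pp (ind (m ∧ not b) ℕ.* D) * invPow q pp (ind (b ∧ not r) ℕ.* E))

  arcWeight : (m r : Bool) (D E : ℕ) → Bool → ℚ
  arcWeight m r D E b = ι (b ⇒ᵇ m) * (ι (r ⇒ᵇ b) * arcTerm m r b D E)

  arcWeight-sum : ∀ m r D E → T (r ⇒ᵇ m) →
                  Σℚ (true ∷ false ∷ []) (arcWeight m r D E) ≡
                  (if m ∧ not r then invPow q pp E - invPow q pp D else 1ℚ)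
  arcWeight-sum true  true  D E _ =
    cong (λ x → 1ℚ + (1ℚ * x + 0ℚ)) (ℚ.*-zeroˡ (arcTerm true true false D E))
  arcWeight-sum false false D E _ =
    cong (λ x → x + (1ℚ + 0ℚ)) (ℚ.*-zeroˡ (1ℚ * arcTerm false false true D E))
  arcWeight-sum true  false D E _ rewrite ℕ.+-identityʳ D | ℕ.+-identityʳ E =
    solve 2 (λ x y → con 1ℚ :* (con 1ℚ :* (con 1ℚ :* (con 1ℚ :* x)))
                     :+ (con 1ℚ :* (con 1ℚ :* ((con (- 1ℚ) :* con 1ℚ) :* (y :* con 1ℚ))) :+ con 0ℚ)
                     := x :- y)
            refl (invPow q pp E) (invPow q pp D)
    where open +-*-Solver

module ArcExpansion (q : ℕ) (pp : IsPrimePower q) {n : ℕ} (φ : LinOrd n) (J : Sub n) (lam μ : Arcs n)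
  where

  λJ : Arcs n
  λJ = restrict J lam

  nstμ nstλ : Fin n → Fin n → ℕ
  nstμ i j = nst φ μ (arc i j)
  nstλ i j = nst φ lam (arc i j)

  summand : Arcs n → ℚ
  summand ν = (- 1ℚ) ^ℚ size (μ ∖ ν) * invPow q pp (nst φ μ (μ ∖ ν) ℕ.+ nst φ lam (ν ∖ λJ))

  Admissible : Arcs n → Bool
  Admissible ν = isSetPartition φ J ν ∧ (ν ⊆ᵇ μ) ∧ (λJ ⊆ᵇ ν)

  arcTermAt arcWeightAt : Fin n → Fin n → Bool → ℚ
  arcTermAt   i j b = arcTerm q pp (μ i j) (λJ i j) b (nstμ i j) (nstλ i j)
  arcWeightAt i j   = arcWeight q pp (μ i j) (λJ i j) (nstμ i j) (nstλ i j)

  arcFactor : Fin n → Fin n → ℚ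
  arcFactor i j = invPow q pp (nstλ i j) - invPow q pp (nstμ i j)

  summand≡∏∏ : ∀ ν → summand ν ≡ ∏[ i < n ] ∏[ j < n ] arcTermAt i j (ν i j)
  summand≡∏∏ ν = begin
    summand ν
      ≡⟨ cong₂ (λ s t → (- 1ℚ) ^ℚ s * invPow q pp t)
           (size≡∑∑ (μ ∖ ν)) (cong₂ ℕ._+_ (nst-linear φ μ (μ ∖ ν)) (nst-linear φ lam (ν ∖ λJ))) ⟩
    (- 1ℚ) ^ℚ (∑[ i < n ] ∑[ j < n ] a i j) * invPow q pp (Nμ ℕ.+ Nλ)
      ≡⟨ cong₂ _*_ (homo-∑∑≡∏∏ ((- 1ℚ) ^ℚ_) refl (^ℚ-+ (- 1ℚ)) a)
           (trans (invPow-+ q pp Nμ Nλ)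
                  (cong₂ _*_ (homo-∑∑≡∏∏ (invPow q pp) refl (invPow-+ q pp) B′)
                             (homo-∑∑≡∏∏ (invPow q pp) refl (invPow-+ q pp) C′))) ⟩
    (∏[ i < n ] ∏[ j < n ] A i j) * ((∏[ i < n ] ∏[ j < n ] B i j) * (∏[ i < n ] ∏[ j < n ] C i j))
      ≡⟨ ∏∏-distrib-*³ A B C ⟩
    ∏[ i < n ] ∏[ j < n ] arcTermAt i j (ν i j)
      ∎
    where
    open ≡-Reasoning
    a b : Fin n → Fin n → ℕ
    a i j = ind ((μ ∖ ν) i j)
    b i j = ind ((ν ∖ λJ) i j)
    B′ C′ : Fin n → Fin n → ℕ
    B′ i j = a i j ℕ.* nstμ i j
    C′ i j = b i j ℕ.* nstλ i j
    Nμ Nλ : ℕ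
    Nμ = ∑[ i < n ] ∑[ j < n ] B′ i j
    Nλ = ∑[ i < n ] ∑[ j < n ] C′ i j
    A B C : Fin n → Fin n → ℚ
    A i j = (- 1ℚ) ^ℚ a i j
    B i j = invPow q pp (B′ i j)
    C i j = invPow q pp (C′ i j)

  Admissible≡between : T (isSetPartition φ J μ) → ∀ ν → Admissible ν ≡ (ν ⊆ᵇ μ) ∧ (λJ ⊆ᵇ ν)
  Admissible≡between spμ ν = ∧-redundantˡ {isSetPartition φ J ν} {(ν ⊆ᵇ μ) ∧ (λJ ⊆ᵇ ν)}
    λ t → isSetPartition-⊆ φ J (proj₁ (Equivalence.to (T-∧ {ν ⊆ᵇ μ}) t)) spμ

  weighted-summand≡∏∏ : T (isSetPartition φ J μ) → ∀ ν →
                        ι (Admissible ν) * summand ν ≡ ∏[ i < n ] ∏[ j < n ] arcWeightAt i j (ν i j)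
  weighted-summand≡∏∏ spμ ν = begin
    ι (Admissible ν) * summand ν
      ≡⟨ cong₂ _*_ (trans (cong ι (Admissible≡between spμ ν))
                          (trans (ι-∧ (ν ⊆ᵇ μ) (λJ ⊆ᵇ ν)) (cong₂ _*_ (ι-⊆ᵇ ν μ) (ι-⊆ᵇ λJ ν))))
                   (summand≡∏∏ ν) ⟩
    ((∏[ i < n ] ∏[ j < n ] A i j) * (∏[ i < n ] ∏[ j < n ] B i j)) * (∏[ i < n ] ∏[ j < n ] C i j)
      ≡⟨ ℚ.*-assoc (∏[ i < n ] ∏[ j < n ] A i j) _ _ ⟩
    (∏[ i < n ] ∏[ j < n ] A i j) * ((∏[ i < n ] ∏[ j < n ] B i j) * (∏[ i < n ] ∏[ j < n ] C i j))
      ≡⟨ ∏∏-distrib-*³ A B C ⟩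
    ∏[ i < n ] ∏[ j < n ] arcWeightAt i j (ν i j)
      ∎
    where
    open ≡-Reasoning
    A B C : Fin n → Fin n → ℚ
    A i j = ι (ν i j ⇒ᵇ μ i j)
    B i j = ι (λJ i j ⇒ᵇ ν i j)
    C i j = arcTermAt i j (ν i j)

  LHS≡∏∏ : T (isSetPartition φ J μ) →
           LHS q pp φ J lam μ ≡ ∏[ i < n ] ∏[ j < n ] Σℚ (true ∷ false ∷ []) (arcWeightAt i j)
  LHS≡∏∏ spμ = begin
    LHS q pp φ J lam μ
      ≡⟨ Σℚ-filterᵇ Admissible (allArcs n) summand ⟩
    Σℚ (allArcs n) (λ ν → ι (Admissible ν) * summand ν)
      ≡⟨ Σℚ-cong (allArcs n) (weighted-summand≡∏∏ spμ) ⟩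
    Σℚ (allArcs n) (λ ν → ∏[ i < n ] ∏[ j < n ] arcWeightAt i j (ν i j))
      ≡⟨ Σℚ-funs-∏ n _ (λ i row → ∏[ j < n ] arcWeightAt i j (row j)) ⟩
    ∏[ i < n ] Σℚ (funs n (true ∷ false ∷ [])) (λ row → ∏[ j < n ] arcWeightAt i j (row j))
      ≡⟨ ∏-cong (λ i → Σℚ-funs-∏ n _ (arcWeightAt i)) ⟩
    ∏[ i < n ] ∏[ j < n ] Σℚ (true ∷ false ∷ []) (arcWeightAt i j)
      ∎
    where open ≡-Reasoning

  RHS≡∏∏ : RHS q pp φ J lam μ ≡ ∏[ i < n ] ∏[ j < n ] (if (μ ∖ λJ) i j then arcFactor i j else 1ℚ)
  RHS≡∏∏ = Πarcs≡∏∏ (μ ∖ λJ) arcFactor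

lemma4p4 : (q : ℕ) (pp : IsPrimePower q) (n : ℕ) (φ : LinOrd n) (J : Sub n)
           (lam : Arcs n) (μ : Arcs n) →
           T (isSetPartition φ full lam) →
           T (isSetPartition φ J μ) →
           T (restrict J lam ⊆ᵇ μ) →
           LHS q pp φ J lam μ ≡ RHS q pp φ J lam μ
lemma4p4 q pp n φ J lam μ _ spμ λJ⊆μ = begin
  LHS q pp φ J lam μ
    ≡⟨ LHS≡∏∏ spμ ⟩
  ∏[ i < n ] ∏[ j < n ] Σℚ (true ∷ false ∷ []) (arcWeightAt i j)
    ≡⟨ ∏-cong (λ i → ∏-cong λ j →
         arcWeight-sum q pp (μ i j) (λJ i j) (nstμ i j) (nstλ i j) (∀ᵇ-elim (∀ᵇ-elim λJ⊆μ i) j)) ⟩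
  ∏[ i < n ] ∏[ j < n ] (if (μ ∖ λJ) i j then arcFactor i j else 1ℚ)
    ≡⟨ RHS≡∏∏ ⟨
  RHS q pp φ J lam μ
    ∎
  where
  open ≡-Reasoning
  open ArcExpansion q pp φ J lam μ
  open ∀ᵇ-Reflection n
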